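{- Let $L,M\subseteq\mathcal{H}_n$ be root subspaces. Then $L\cap M$ is a root subspace if and only if every cycle of length at least four in the graph $\Gamma_L\cup\Gamma_M$ has a chord.
   Context: $\mathcal{H}_n=\{x\in\mathbb{R}^n:\sum x_i=0\}$; roots are $e_{ij}=e_i-e_j$ ($i\ne j$); a root subspace is a linear subspace spanned by roots. For a root subspace $L$, $\Gamma_L$ is the simple undirected graph on vertex set $[n]$ with an edge $\{i,j\}$ whenever $e_{ij}\in L$. $\Gamma_L\cup\Gamma_M$ is the graph on $[n]$ whose edge set is the union of the edge sets. A chord of a cycle is an edge connecting two vertices of the cycle that are not adjacent in the cycle.
   Formalization: The space $\mathcal{H}_n$ and the root subspaces $L,M$ are taken over ℚ instead of ℝ, with rational coordinates and rational coefficients in spans of roots. -}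

module Defs where

open import Data.Nat using (ℕ; zero; suc; _+_)
open import Data.Fin using (Fin; zero; suc; _≟_)
open import Data.Rational using (ℚ; 0ℚ; 1ℚ; -_) renaming (_+_ to _+ℚ_; _*_ to _*ℚ_)
open import Data.Product using (Σ; _×_; _,_; proj₁)
open import Data.Sum using (_⊎_)
open import Data.List using (List; []; _∷_)
open import Data.List.Relation.Unary.All using (All)
open import Data.List.Membership.Propositional using (_∈_)
open import Relation.Nullary using (¬_; yes; no)
open import Relation.Binary.PropositionalEquality using (_≡_; _≢_)
open import Function.Definitions using (Injective)

Vecℚ : ℕ → Set
Vecℚ n = Fin n → ℚ

sumℚ : ∀ {n} → Vecℚ n → ℚ
sumℚ {zero} x = 0ℚ
sumℚ {suc n} x = x zero +ℚ sumℚ (λ k → x (suc k))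

Hₙ : ∀ n → Vecℚ n → Set
Hₙ n x = sumℚ x ≡ 0ℚ

root : ∀ {n} → Fin n → Fin n → Vecℚ n
root i j k with k ≟ i | k ≟ j
... | yes _ | _     = 1ℚ
... | no _  | yes _ = - 1ℚ
... | no _  | no _  = 0ℚ

lincomb : ∀ {n} → List ((Fin n × Fin n) × ℚ) → Vecℚ n
lincomb []                   k = 0ℚ
lincomb (((i , j) , c) ∷ cs) k = (c *ℚ root i j k) +ℚ lincomb cs k

InSpan : ∀ {n} → List (Fin n × Fin n) → Vecℚ n → Set
InSpan {n} rs v =
  Σ (List ((Fin n × Fin n) × ℚ)) λ cs →
    All (λ t → proj₁ t ∈ rs) cs × (∀ k → v k ≡ lincomb cs k)

IsRootSubspace : ∀ n → (Vecℚ n → Set) → Set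
IsRootSubspace n L =
  Σ (List (Fin n × Fin n)) λ rs →
    All (λ p → proj₁ p ≢ Data.Product.proj₂ p) rs ×
    (∀ v → (L v → InSpan rs v) × (InSpan rs v → L v))

_∩_ : ∀ {n} → (Vecℚ n → Set) → (Vecℚ n → Set) → (Vecℚ n → Set)
(L ∩ M) v = L v × M v

Γ : ∀ {n} → (Vecℚ n → Set) → Fin n → Fin n → Set
Γ L i j = i ≢ j × L (root i j)

Γ∪ : ∀ {n} → (Vecℚ n → Set) → (Vecℚ n → Set) → Fin n → Fin n → Set
Γ∪ L M i j = Γ L i j ⊎ Γ M i j

-- Cyclic successor on Fin (suc k): i ↦ i + 1 mod (suc k).
next : ∀ {k} → Fin (suc k) → Fin (suc k)
next {zero}  zero    = zero
next {suc k} zero    = suc zero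
next {suc k} (suc i) with next {k} i
... | zero  = zero
... | suc j = suc (suc j)

IsCycle : ∀ {n m} → (Fin n → Fin n → Set) → (Fin (suc m) → Fin n) → Set
IsCycle Adj c = Injective _≡_ _≡_ c × (∀ a → Adj (c a) (c (next a)))

HasChord : ∀ {n m} → (Fin n → Fin n → Set) → (Fin (suc m) → Fin n) → Set
HasChord {m = m} Adj c =
  Σ (Fin (suc m)) λ a → Σ (Fin (suc m)) λ b →
    a ≢ b × b ≢ next a × a ≢ next b × Adj (c a) (c b)

-- A root subspace is determined by a partition of [n]: it consists of the vectors whose sum over
-- every block vanishes, and Γ_L joins two vertices iff they share a block.  If α and β label the
-- blocks of L and M, then L ∩ M is a root subspace iff it is the subspace of the common refinement
-- ⟨α, β⟩, i.e. iff the refined block sums σ(x, y) of every v ∈ L ∩ M vanish.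
-- A chordless cycle of length ≥ 4 in Γ_L ∪ Γ_M alternates between α-edges and β-edges; the sum of
-- the roots along its α-edges lies in L ∩ M, yet its σ at the block of a cycle vertex is ±1.
-- Conversely, for v ∈ L ∩ M the matrix σ has vanishing row and column sums, so a nonzero entry starts
-- a non-backtracking walk through nonzero entries, alternately changing row and column.  Its first
-- repetition closes a cycle of length ≥ 4, and a vertex of [n] in each block along it forms a
-- chordless cycle of Γ_L ∪ Γ_M.

module Submission where

open import Defs
open import Algebra.Bundles using (Ring)
open import Data.Bool using (Bool; true; false)
open import Data.Empty using (⊥)
open import Data.Fin using (Fin; zero; suc; toℕ; fromℕ; fromℕ<; inject₁; join; splitAt)
open import Data.Fin.Instances
open import Data.Fin.Properties
  using (suc-injective; toℕ-injective; toℕ<n; toℕ-fromℕ; toℕ-fromℕ<; toℕ-inject₁; splitAt-join;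
         any?; ¬∀⟶∃¬; pigeonhole)
open import Data.Fin.Relation.Unary.Top using (view; ‵fromℕ; ‵inject₁)
open import Data.List using (List; []; _∷_; _++_; map; concat; tabulate; filter; cartesianProduct; allFin)
open import Data.List.Membership.Propositional using (_∈_)
open import Data.List.Membership.Propositional.Properties
  using (∈-filter⁺; ∈-filter⁻; ∈-cartesianProduct⁺; ∈-allFin)
open import Data.List.Relation.Unary.All as All using (All; []; _∷_)
import Data.List.Relation.Unary.All.Properties as All
open import Data.List.Relation.Unary.Any using (here; there)
open import Data.Nat as ℕ using (ℕ; zero; suc; _<_; z<s; s<s)
open import Data.Nat.DivMod using (_%_; %-distribˡ-+; m%n%n≡m%n; n%n≡0; m<n⇒m%n≡m; m≤n⇒[n∸m]%m≡n%m)
import Data.Nat.Properties as ℕ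
open import Data.Product using (Σ; ∃; _×_; _,_; proj₁; proj₂; uncurry; map₂; <_,_>)
open import Data.Product.Function.NonDependent.Propositional using (_×-⇔_)
open import Data.Product.Instances
open import Data.Rational using (ℚ; 0ℚ; 1ℚ; -_; _+_; _*_; _-_)
import Data.Rational.Properties as ℚ
open import Data.Rational.Solver using (module +-*-Solver)
open import Data.Sum as Sum using (_⊎_; inj₁; inj₂; [_,_])
open import Data.Sum.Function.Propositional using (_⊎-⇔_)
open import Data.Sum.Properties using (inj₁-injective; inj₂-injective)
open import Function using (_∘_; id; flip; const)
open import Function.Bundles using (_⇔_; mk⇔; Equivalence)
open import Function.Definitions using (Injective)
import Function.Properties.Equivalence as ⇔
open import Relation.Binary.PropositionalEquality
  using (_≡_; _≢_; refl; sym; trans; cong; cong₂; subst; subst₂; module ≡-Reasoning)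
open import Relation.Binary.Structures using (IsEquivalence)
open import Relation.Binary.TypeClasses using (IsDecEquivalence; _≟_)
open import Relation.Unary using (_⊆_)
open import Relation.Nullary using (¬_; Dec; yes; no; ¬?; _×-dec_; _⊎-dec_; _→-dec_; contradiction)

open import Algebra.Properties.Semiring.Sum (Ring.semiring ℚ.+-*-ring)
  using (sum; sum-cong-≗; sum-replicate-zero; sum-init-last; ∑-distrib-+; ∑-comm; *-distribˡ-sum)
open +-*-Solver

sum-zero : ∀ {n} {f : Fin n → ℚ} → (∀ i → f i ≡ 0ℚ) → sum f ≡ 0ℚ
sum-zero {n} f≡0 = trans (sum-cong-≗ f≡0) (sum-replicate-zero n)

sum-select : ∀ {n} {f : Fin n → ℚ} i → (∀ j → j ≢ i → f j ≡ 0ℚ) → sum f ≡ f i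
sum-select {f = f} zero others =
  trans (cong (f zero +_) (sum-zero (λ j → others (suc j) λ ()))) (ℚ.+-identityʳ (f zero))
sum-select {f = f} (suc i) others =
  trans (cong₂ _+_ (others zero λ ()) (sum-select i λ j j≢i → others (suc j) (j≢i ∘ suc-injective)))
        (ℚ.+-identityˡ (f (suc i)))

sum-neg : ∀ {n} (f : Fin n → ℚ) → sum (λ i → - f i) ≡ - sum f
sum-neg {zero}  f = refl
sum-neg {suc n} f =
  trans (cong (- f zero +_) (sum-neg (f ∘ suc))) (sym (ℚ.neg-distrib-+ (f zero) (sum (f ∘ suc))))

sum≢0⇒∃≢0 : ∀ {n} {f : Fin n → ℚ} → sum f ≢ 0ℚ → ∃ λ i → f i ≢ 0ℚ
sum≢0⇒∃≢0 {n} {f} Σf≢0 = ¬∀⟶∃¬ n _ (λ i → f i ℚ.≟ 0ℚ) (Σf≢0 ∘ sum-zero)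

sum≡0⇒∃other≢0 : ∀ {n} {f : Fin n → ℚ} {i} → sum f ≡ 0ℚ → f i ≢ 0ℚ → ∃ λ j → j ≢ i × f j ≢ 0ℚ
sum≡0⇒∃other≢0 {n} {f} {i} Σf≡0 fi≢0
  with j , ¬[j≢i⇒fj≡0] ← ¬∀⟶∃¬ n _ (λ j → ¬? (j ≟ i) →-dec f j ℚ.≟ 0ℚ)
                           (λ others → fi≢0 (trans (sym (sum-select i others)) Σf≡0))
  = j , (λ j≡i → ¬[j≢i⇒fj≡0] λ j≢i → contradiction j≡i j≢i) , (λ fj≡0 → ¬[j≢i⇒fj≡0] λ _ → fj≡0)

next-inject₁ : ∀ {m} (i : Fin m) → next (inject₁ i) ≡ suc i
next-inject₁ {suc m} zero    = refl
next-inject₁ {suc m} (suc i) rewrite next-inject₁ i = refl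

next-fromℕ : ∀ m → next (fromℕ m) ≡ zero
next-fromℕ zero    = refl
next-fromℕ (suc m) rewrite next-fromℕ m = refl

next-injective : ∀ {m} → Injective _≡_ _≡_ (next {m})
next-injective {m} {a} {b} eq with view a | view b
... | ‵fromℕ     | ‵fromℕ     = refl
... | ‵fromℕ     | ‵inject₁ j = contradiction (trans (sym (next-fromℕ m)) (trans eq (next-inject₁ j))) λ ()
... | ‵inject₁ i | ‵fromℕ     = contradiction (trans (sym (next-inject₁ i)) (trans eq (next-fromℕ m))) λ ()
... | ‵inject₁ i | ‵inject₁ j =
  cong inject₁ (suc-injective (trans (sym (next-inject₁ i)) (trans eq (next-inject₁ j))))

sum-∘next : ∀ {m} (f : Fin (suc m) → ℚ) → sum (f ∘ next) ≡ sum f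
sum-∘next {m} f = begin
  sum (f ∘ next)                                           ≡⟨ sum-init-last (f ∘ next) ⟩
  sum (f ∘ next ∘ inject₁) + f (next (fromℕ m))            ≡⟨ cong₂ _+_ (sum-cong-≗ (cong f ∘ next-inject₁))
                                                                         (cong f (next-fromℕ m)) ⟩
  sum (f ∘ suc) + f zero                                   ≡⟨ ℚ.+-comm _ (f zero) ⟩
  sum f                                                    ∎
  where open ≡-Reasoning

sum-- : ∀ {n} (f g : Fin n → ℚ) → sum (λ i → f i - g i) ≡ sum f - sum g
sum-- {n} f g = trans (∑-distrib-+ {n} f (λ i → - g i)) (cong (sum f +_) (sum-neg g))

sum-telescope : ∀ {m} (f : Fin (suc m) → ℚ) → sum (λ a → f a - f (next a)) ≡ 0ℚ
sum-telescope f = begin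
  sum (λ a → f a - f (next a))  ≡⟨ sum-- f (f ∘ next) ⟩
  sum f - sum (f ∘ next)        ≡⟨ cong (λ x → sum f - x) (sum-∘next f) ⟩
  sum f - sum f                 ≡⟨ ℚ.+-inverseʳ (sum f) ⟩
  0ℚ                            ∎
  where open ≡-Reasoning

toℕ-next : ∀ {m} (a : Fin (suc m)) → toℕ (next a) ≡ suc (toℕ a) % suc m
toℕ-next {m} a with view a
... | ‵fromℕ = begin
  toℕ (next (fromℕ m))        ≡⟨ cong toℕ (next-fromℕ m) ⟩
  0                           ≡⟨ n%n≡0 (suc m) ⟨
  suc m % suc m               ≡⟨ cong (λ x → suc x % suc m) (toℕ-fromℕ m) ⟨
  suc (toℕ (fromℕ m)) % suc m ∎
  where open ≡-Reasoning
... | ‵inject₁ i = begin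
  toℕ (next (inject₁ i))          ≡⟨ cong toℕ (next-inject₁ i) ⟩
  suc (toℕ i)                     ≡⟨ m<n⇒m%n≡m (ℕ.s≤s (toℕ<n i)) ⟨
  suc (toℕ i) % suc m             ≡⟨ cong (λ x → suc x % suc m) (toℕ-inject₁ i) ⟨
  suc (toℕ (inject₁ i)) % suc m   ∎
  where open ≡-Reasoning

[j+x]%n≢x : ∀ {j x m} → x < suc m → 0 < j → j < suc m → (j ℕ.+ x) % suc m ≢ x
[j+x]%n≢x {j} {x} {m} x<n 0<j j<n eq with j ℕ.+ x ℕ.<? suc m
... | yes j+x<n = ℕ.<⇒≢ (ℕ.m<n+m x 0<j) (sym (trans (sym (m<n⇒m%n≡m j+x<n)) eq))
... | no  j+x≮n = ℕ.<⇒≢ j<n (ℕ.+-cancelʳ-≡ x j (suc m) (begin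
    j ℕ.+ x                      ≡⟨ ℕ.m∸n+n≡m n≤j+x ⟨
    (j ℕ.+ x ℕ.∸ suc m) ℕ.+ suc m ≡⟨ cong (ℕ._+ suc m) (trans (sym [j+x]%n≡d) eq) ⟩
    x ℕ.+ suc m                  ≡⟨ ℕ.+-comm x (suc m) ⟩
    suc m ℕ.+ x                  ∎))
  where
  open ≡-Reasoning
  n≤j+x = ℕ.≮⇒≥ j+x≮n
  [j+x]%n≡d : (j ℕ.+ x) % suc m ≡ j ℕ.+ x ℕ.∸ suc m
  [j+x]%n≡d = trans (sym (m≤n⇒[n∸m]%m≡n%m n≤j+x))
                    (m<n⇒m%n≡m (ℕ.m<n+o⇒m∸n<o (j ℕ.+ x) (suc m) (ℕ.+-mono-< j<n x<n)))

nextⁿ : ∀ {m} → ℕ → Fin (suc m) → Fin (suc m)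
nextⁿ zero    a = a
nextⁿ (suc j) a = next (nextⁿ j a)

toℕ-nextⁿ : ∀ {m} j (a : Fin (suc m)) → toℕ (nextⁿ j a) ≡ (j ℕ.+ toℕ a) % suc m
toℕ-nextⁿ {m} zero    a = sym (m<n⇒m%n≡m (toℕ<n a))
toℕ-nextⁿ {m} (suc j) a = begin
  toℕ (next (nextⁿ j a))                ≡⟨ toℕ-next (nextⁿ j a) ⟩
  suc (toℕ (nextⁿ j a)) % suc m         ≡⟨ cong (λ x → suc x % suc m) (toℕ-nextⁿ j a) ⟩
  (1 ℕ.+ (j ℕ.+ toℕ a) % suc m) % suc m ≡⟨ %-distribˡ-+ 1 ((j ℕ.+ toℕ a) % suc m) (suc m) ⟩
  (1 % suc m ℕ.+ (j ℕ.+ toℕ a) % suc m % suc m) % suc m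
                                        ≡⟨ cong (λ x → (1 % suc m ℕ.+ x) % suc m)
                                                (m%n%n≡m%n (j ℕ.+ toℕ a) (suc m)) ⟩
  (1 % suc m ℕ.+ (j ℕ.+ toℕ a) % suc m) % suc m ≡⟨ %-distribˡ-+ 1 (j ℕ.+ toℕ a) (suc m) ⟨
  (suc j ℕ.+ toℕ a) % suc m             ∎
  where open ≡-Reasoning

nextⁿ≢id : ∀ {m j} (a : Fin (suc m)) → 0 < j → j < suc m → nextⁿ j a ≢ a
nextⁿ≢id {j = j} a 0<j j<n eq = [j+x]%n≢x (toℕ<n a) 0<j j<n (trans (sym (toℕ-nextⁿ j a)) (cong toℕ eq))

next≢id : ∀ {m} (a : Fin (2 ℕ.+ m)) → next a ≢ a
next≢id a = nextⁿ≢id {j = 1} a z<s (s<s z<s)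

next∘next≢id : ∀ {m} (a : Fin (3 ℕ.+ m)) → next (next a) ≢ a
next∘next≢id a = nextⁿ≢id {j = 2} a z<s (s<s (s<s z<s))

next∘next∘next≢id : ∀ {m} (a : Fin (4 ℕ.+ m)) → next (next (next a)) ≢ a
next∘next∘next≢id a = nextⁿ≢id {j = 3} a z<s (s<s (s<s (s<s z<s)))

𝟙 : ∀ {a} {A : Set a} → Dec A → ℚ
𝟙 (yes _) = 1ℚ
𝟙 (no _)  = 0ℚ

𝟙-yes : ∀ {a} {A : Set a} (d : Dec A) → A → 𝟙 d ≡ 1ℚ
𝟙-yes (yes _) _ = refl
𝟙-yes (no ¬a) a = contradiction a ¬a

𝟙-no : ∀ {a} {A : Set a} (d : Dec A) → ¬ A → 𝟙 d ≡ 0ℚ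
𝟙-no (yes a) ¬a = contradiction a ¬a
𝟙-no (no _)  _  = refl

𝟙-cong : ∀ {a b} {A : Set a} {B : Set b} (d : Dec A) (e : Dec B) → (A → B) → (B → A) → 𝟙 d ≡ 𝟙 e
𝟙-cong (yes a) e to from = sym (𝟙-yes e (to a))
𝟙-cong (no ¬a) e to from = sym (𝟙-no e (¬a ∘ from))

module _ {K : Set} {{_ : IsDecEquivalence {A = K} _≡_}} where

  𝟙[≡]-diff≡0 : ∀ {y z : K} x → y ≡ z → 𝟙 (y ≟ x) - 𝟙 (z ≟ x) ≡ 0ℚ
  𝟙[≡]-diff≡0 {y} x refl = ℚ.+-inverseʳ (𝟙 (y ≟ x))

  𝟙[≟]*diff≡0 : ∀ (y z x : K) → 𝟙 (y ≟ z) * (𝟙 (y ≟ x) - 𝟙 (z ≟ x)) ≡ 0ℚ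
  𝟙[≟]*diff≡0 y z x with y ≟ z
  ... | yes y≡z = trans (cong (1ℚ *_) (𝟙[≡]-diff≡0 x y≡z)) refl
  ... | no  _   = ℚ.*-zeroˡ (𝟙 (y ≟ x) - 𝟙 (z ≟ x))

root≡𝟙-𝟙 : ∀ {n} {i j : Fin n} → i ≢ j → ∀ k → root i j k ≡ 𝟙 (k ≟ i) - 𝟙 (k ≟ j)
root≡𝟙-𝟙 {i = i} {j} i≢j k with k ≟ i | k ≟ j
... | yes refl | yes refl = contradiction refl i≢j
... | yes _    | no _     = refl
... | no _     | yes _    = refl
... | no _     | no _     = refl

root-antisym : ∀ {n} {i j : Fin n} → i ≢ j → ∀ k → - 1ℚ * root i j k ≡ root j i k
root-antisym {i = i} {j} i≢j k = begin
  - 1ℚ * root i j k                    ≡⟨ cong (- 1ℚ *_) (root≡𝟙-𝟙 i≢j k) ⟩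
  - 1ℚ * (𝟙 (k ≟ i) - 𝟙 (k ≟ j))       ≡⟨ solve 2 (λ x y → (:- con 1ℚ) :* (x :- y) := y :- x) refl
                                             (𝟙 (k ≟ i)) (𝟙 (k ≟ j)) ⟩
  𝟙 (k ≟ j) - 𝟙 (k ≟ i)                ≡⟨ root≡𝟙-𝟙 (i≢j ∘ sym) k ⟨
  root j i k                           ∎
  where open ≡-Reasoning

root-trans : ∀ {n} {i j l : Fin n} → i ≢ j → j ≢ l → i ≢ l → ∀ k → root i j k + root j l k ≡ root i l k
root-trans {i = i} {j} {l} i≢j j≢l i≢l k = begin
  root i j k + root j l k                             ≡⟨ cong₂ _+_ (root≡𝟙-𝟙 i≢j k) (root≡𝟙-𝟙 j≢l k) ⟩
  (𝟙 (k ≟ i) - 𝟙 (k ≟ j)) + (𝟙 (k ≟ j) - 𝟙 (k ≟ l))   ≡⟨ solve 3 (λ x y z → (x :- y) :+ (y :- z) := x :- z) refl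
                                                           (𝟙 (k ≟ i)) (𝟙 (k ≟ j)) (𝟙 (k ≟ l)) ⟩
  𝟙 (k ≟ i) - 𝟙 (k ≟ l)                               ≡⟨ root≡𝟙-𝟙 i≢l k ⟨
  root i l k                                          ∎
  where open ≡-Reasoning

sum-𝟙* : ∀ {n} (f : Fin n → ℚ) i → sum (λ k → 𝟙 (k ≟ i) * f k) ≡ f i
sum-𝟙* f i = begin
  sum (λ k → 𝟙 (k ≟ i) * f k) ≡⟨ sum-select i others ⟩
  𝟙 (i ≟ i) * f i             ≡⟨ cong (_* f i) (𝟙-yes (i ≟ i) refl) ⟩
  1ℚ * f i                    ≡⟨ ℚ.*-identityˡ (f i) ⟩
  f i                         ∎
  where
  open ≡-Reasoning
  others : ∀ k → k ≢ i → 𝟙 (k ≟ i) * f k ≡ 0ℚ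
  others k k≢i = trans (cong (_* f k) (𝟙-no (k ≟ i) k≢i)) (ℚ.*-zeroˡ (f k))

sum-𝟙[next≟0]* : ∀ {m} (d : Fin (suc m) → ℚ) → sum (λ a → 𝟙 (next a ≟ zero) * d a) ≡ d (fromℕ m)
sum-𝟙[next≟0]* {m} d = trans (sum-cong-≗ λ a → cong (_* d a) (𝟙-cong (next a ≟ zero) (a ≟ fromℕ m)
                                (λ a⁺≡0 → next-injective (trans a⁺≡0 (sym (next-fromℕ m))))
                                (λ a≡last → trans (cong next a≡last) (next-fromℕ m))))
                             (sum-𝟙* d (fromℕ m))

sum-*[𝟙-𝟙∘next] : ∀ {m} (d : Fin (suc m) → ℚ) →
                  sum (λ a → d a * (𝟙 (a ≟ zero) - 𝟙 (next a ≟ zero))) ≡ d zero - d (fromℕ m)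
sum-*[𝟙-𝟙∘next] {m} d = begin
  sum (λ a → d a * (𝟙 (a ≟ zero) - 𝟙 (next a ≟ zero)))
    ≡⟨ sum-cong-≗ (λ a → solve 3 (λ x y z → x :* (y :- z) := y :* x :- z :* x) refl
                                 (d a) (𝟙 (a ≟ zero)) (𝟙 (next a ≟ zero))) ⟩
  sum (λ a → 𝟙 (a ≟ zero) * d a - 𝟙 (next a ≟ zero) * d a)
    ≡⟨ sum-- (λ a → 𝟙 (a ≟ zero) * d a) (λ a → 𝟙 (next a ≟ zero) * d a) ⟩
  sum (λ a → 𝟙 (a ≟ zero) * d a) - sum (λ a → 𝟙 (next a ≟ zero) * d a)
    ≡⟨ cong₂ _-_ (sum-𝟙* d zero) (sum-𝟙[next≟0]* d) ⟩
  d zero - d (fromℕ m)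
    ∎
  where open ≡-Reasoning

dot : ∀ {n} → (Fin n → ℚ) → Vecℚ n → ℚ
dot g v = sum (λ k → g k * v k)

module _ {n} (g : Fin n → ℚ) where

  dot-cong : ∀ {v w : Vecℚ n} → (∀ k → v k ≡ w k) → dot g v ≡ dot g w
  dot-cong v≗w = sum-cong-≗ (cong (g _ *_) ∘ v≗w)

  dot-+ : ∀ (v w : Vecℚ n) → dot g (λ k → v k + w k) ≡ dot g v + dot g w
  dot-+ v w = trans (sum-cong-≗ λ k → ℚ.*-distribˡ-+ (g k) (v k) (w k)) (∑-distrib-+ {n} _ _)

  dot-* : ∀ c (v : Vecℚ n) → dot g (λ k → c * v k) ≡ c * dot g v
  dot-* c v = trans (sum-cong-≗ λ k → solve 3 (λ x c y → x :* (c :* y) := c :* (x :* y)) refl (g k) c (v k))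
                    (sym (*-distribˡ-sum {n} c _))

  dot-- : ∀ (v w : Vecℚ n) → dot g (λ k → v k - w k) ≡ dot g v - dot g w
  dot-- v w = trans (sum-cong-≗ λ k → solve 3 (λ x y z → x :* (y :- z) := x :* y :- x :* z) refl
                                              (g k) (v k) (w k))
                    (sum-- (λ k → g k * v k) (λ k → g k * w k))

  dot-𝟙 : ∀ i → dot g (λ k → 𝟙 (k ≟ i)) ≡ g i
  dot-𝟙 i = trans (sum-cong-≗ λ k → ℚ.*-comm (g k) _) (sum-𝟙* g i)

  dot-root : ∀ {i j} → i ≢ j → dot g (root i j) ≡ g i - g j
  dot-root {i} {j} i≢j = begin
    dot g (root i j)                                    ≡⟨ dot-cong (root≡𝟙-𝟙 i≢j) ⟩
    dot g (λ k → 𝟙 (k ≟ i) - 𝟙 (k ≟ j))                 ≡⟨ dot-- _ _ ⟩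
    dot g (λ k → 𝟙 (k ≟ i)) - dot g (λ k → 𝟙 (k ≟ j))   ≡⟨ cong₂ _-_ (dot-𝟙 i) (dot-𝟙 j) ⟩
    g i - g j                                           ∎
    where open ≡-Reasoning

  dot-∑ : ∀ {m} (F : Fin m → Vecℚ n) → dot g (λ k → sum (λ a → F a k)) ≡ sum (λ a → dot g (F a))
  dot-∑ {m} F = trans (sum-cong-≗ λ k → *-distribˡ-sum {m} (g k) (λ a → F a k)) (∑-comm {n} {m} _)

  dot-span≡0 : ∀ {rs v} → All (uncurry λ i j → i ≢ j × g i ≡ g j) rs → InSpan rs v → dot g v ≡ 0ℚ
  dot-span≡0 {rs} rs-ok (cs , cs∈rs , v≗cs) = trans (dot-cong v≗cs) (dot-lincomb cs cs∈rs)
    where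
    dot-lincomb : ∀ cs → All (λ t → proj₁ t ∈ rs) cs → dot g (lincomb cs) ≡ 0ℚ
    dot-lincomb []                   []           = sum-zero λ k → ℚ.*-zeroʳ (g k)
    dot-lincomb (((i , j) , c) ∷ cs) (ij∈rs ∷ cs∈rs) with i≢j , gi≡gj ← All.lookup rs-ok ij∈rs = begin
      dot g (λ k → c * root i j k + lincomb cs k)       ≡⟨ dot-+ _ _ ⟩
      dot g (λ k → c * root i j k) + dot g (lincomb cs) ≡⟨ cong₂ _+_ (dot-* c (root i j)) (dot-lincomb cs cs∈rs) ⟩
      c * dot g (root i j) + 0ℚ                         ≡⟨ cong (λ x → c * x + 0ℚ) (dot-root i≢j) ⟩
      c * (g i - g j) + 0ℚ                              ≡⟨ cong (λ x → c * (x - g j) + 0ℚ) gi≡gj ⟩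
      c * (g j - g j) + 0ℚ                              ≡⟨ solve 2 (λ c x → c :* (x :- x) :+ con 0ℚ := con 0ℚ) refl c (g j) ⟩
      0ℚ                                                ∎
      where open ≡-Reasoning

lincomb-++ : ∀ {n} (cs ds : List ((Fin n × Fin n) × ℚ)) k →
             lincomb (cs ++ ds) k ≡ lincomb cs k + lincomb ds k
lincomb-++ []                   ds k = sym (ℚ.+-identityˡ _)
lincomb-++ (((i , j) , c) ∷ cs) ds k =
  trans (cong (c * root i j k +_) (lincomb-++ cs ds k)) (sym (ℚ.+-assoc (c * root i j k) _ _))

lincomb-scale : ∀ {n} a (cs : List ((Fin n × Fin n) × ℚ)) k →
                lincomb (map (map₂ (a *_)) cs) k ≡ a * lincomb cs k
lincomb-scale a []                   k = sym (ℚ.*-zeroʳ a)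
lincomb-scale a (((i , j) , c) ∷ cs) k =
  trans (cong ((a * c) * root i j k +_) (lincomb-scale a cs k))
        (solve 4 (λ a c r l → (a :* c) :* r :+ a :* l := a :* (c :* r :+ l)) refl
                 a c (root i j k) (lincomb cs k))

lincomb-concat : ∀ {n m} (F : Fin m → List ((Fin n × Fin n) × ℚ)) k →
                 lincomb (concat (tabulate F)) k ≡ sum (λ a → lincomb (F a) k)
lincomb-concat {m = zero}  F k = refl
lincomb-concat {m = suc m} F k =
  trans (lincomb-++ (F zero) _ k) (cong (lincomb (F zero) k +_) (lincomb-concat (F ∘ suc) k))

module _ {n} {rs : List (Fin n × Fin n)} where

  span-≗ : ∀ {v w} → InSpan rs v → (∀ k → v k ≡ w k) → InSpan rs w
  span-≗ (cs , cs∈rs , v≗cs) v≗w = cs , cs∈rs , λ k → trans (sym (v≗w k)) (v≗cs k)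

  span-+ : ∀ {v w} → InSpan rs v → InSpan rs w → InSpan rs (λ k → v k + w k)
  span-+ (cs , cs∈rs , v≗cs) (ds , ds∈rs , w≗ds) =
    cs ++ ds , All.++⁺ cs∈rs ds∈rs , λ k → trans (cong₂ _+_ (v≗cs k) (w≗ds k)) (sym (lincomb-++ cs ds k))

  span-* : ∀ {v} a → InSpan rs v → InSpan rs (λ k → a * v k)
  span-* a (cs , cs∈rs , v≗cs) =
    map (map₂ (a *_)) cs , All.map⁺ cs∈rs , λ k → trans (cong (a *_) (v≗cs k)) (sym (lincomb-scale a cs k))

  span-root : ∀ {i j} → (i , j) ∈ rs → InSpan rs (root i j)
  span-root {i} {j} ij∈rs =
    ((i , j) , 1ℚ) ∷ [] , ij∈rs ∷ [] , λ k → solve 1 (λ r → r := con 1ℚ :* r :+ con 0ℚ) refl (root i j k)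

span-mono : ∀ {n} {rs rs' : List (Fin n × Fin n)} →
            (∀ {i j} → (i , j) ∈ rs → InSpan rs' (root i j)) → ∀ {v} → InSpan rs v → InSpan rs' v
span-mono {rs = rs} {rs'} gen (cs , cs∈rs , v≗cs) = span-≗ (lincomb∈span cs cs∈rs) (sym ∘ v≗cs)
  where
  lincomb∈span : ∀ cs → All (λ t → proj₁ t ∈ rs) cs → InSpan rs' (lincomb cs)
  lincomb∈span []                   []              = [] , [] , λ k → refl
  lincomb∈span (((i , j) , c) ∷ cs) (ij∈rs ∷ cs∈rs) = span-+ (span-* c (gen ij∈rs)) (lincomb∈span cs cs∈rs)

module _ {n : ℕ} {K : Set} {{_ : IsDecEquivalence {A = K} _≡_}} where

  blockSum : (Fin n → K) → K → Vecℚ n → ℚ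
  blockSum κ x = dot (λ k → 𝟙 (κ k ≟ x))

  Balanced : (Fin n → K) → Vecℚ n → Set
  Balanced κ v = ∀ x → blockSum κ x v ≡ 0ℚ

  SameBlock : (Fin n → K) → Fin n → Fin n → Set
  SameBlock κ i j = i ≢ j × κ i ≡ κ j

  blockSum-∑root : ∀ {m} (κ : Fin n → K) x (w : Fin m → ℚ) (i j : Fin m → Fin n) →
                   (∀ a → i a ≢ j a) →
                   blockSum κ x (λ t → sum (λ a → w a * root (i a) (j a) t)) ≡
                   sum (λ a → w a * (𝟙 (κ (i a) ≟ x) - 𝟙 (κ (j a) ≟ x)))
  blockSum-∑root κ x w i j i≢j =
    trans (dot-∑ g (λ a t → w a * root (i a) (j a) t))
          (sum-cong-≗ λ a → trans (dot-* g (w a) (root (i a) (j a)))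
                                  (cong (w a *_) (dot-root g (i≢j a))))
    where g = λ k → 𝟙 (κ k ≟ x)

  module _ (κ : Fin n → K) where

    span⇒balanced : ∀ {rs v} → All (uncurry (SameBlock κ)) rs → InSpan rs v → Balanced κ v
    span⇒balanced rs-ok v∈rs x = dot-span≡0 _ (All.map (map₂ (cong λ y → 𝟙 (y ≟ x))) rs-ok) v∈rs

    blockSum≢0⇒inhabited : ∀ {x v} → blockSum κ x v ≢ 0ℚ → ∃ λ k → κ k ≡ x
    blockSum≢0⇒inhabited {x} {v} blockSum≢0 with k , term≢0 ← sum≢0⇒∃≢0 blockSum≢0 with κ k ≟ x
    ... | yes κk≡x = k , κk≡x
    ... | no  _    = contradiction (ℚ.*-zeroˡ (v k)) term≢0

    balanced-root⇔ : ∀ {i j} → i ≢ j → Balanced κ (root i j) ⇔ κ i ≡ κ j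
    balanced-root⇔ {i} {j} i≢j =
      mk⇔ to (λ κi≡κj → span⇒balanced ((i≢j , κi≡κj) ∷ []) (span-root (here refl)))
      where
      to : Balanced κ (root i j) → κ i ≡ κ j
      to bal with κ j ≟ κ i
      ... | yes κj≡κi = sym κj≡κi
      ... | no  κj≢κi = contradiction (begin
        1ℚ - 0ℚ                             ≡⟨ cong₂ _-_ (𝟙-yes (κ i ≟ κ i) refl) (𝟙-no (κ j ≟ κ i) κj≢κi) ⟨
        𝟙 (κ i ≟ κ i) - 𝟙 (κ j ≟ κ i)       ≡⟨ dot-root (λ k → 𝟙 (κ k ≟ κ i)) i≢j ⟨
        blockSum κ (κ i) (root i j)         ≡⟨ bal (κ i) ⟩
        0ℚ                                  ∎) λ ()
        where open ≡-Reasoning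

    private
      repOf : K → Fin n → Fin n
      repOf x k with any? (λ j → κ j ≟ x)
      ... | yes (j , _) = j
      ... | no  _       = k

      κ-repOf : ∀ {x k} → κ k ≡ x → κ (repOf x k) ≡ x
      κ-repOf {x} κk≡x with any? (λ j → κ j ≟ x)
      ... | yes (_ , κj≡x) = κj≡x
      ... | no  _          = κk≡x

      repOf-irrelevant : ∀ {x k} k' → κ k ≡ x → repOf x k ≡ repOf x k'
      repOf-irrelevant {x} {k} _ κk≡x with any? (λ j → κ j ≟ x)
      ... | yes _  = refl
      ... | no  ¬∃ = contradiction (k , κk≡x) ¬∃

      rep : Fin n → Fin n
      rep k = repOf (κ k) k

      κ-rep : ∀ k → κ (rep k) ≡ κ k
      κ-rep k = κ-repOf refl

      rep-cong : ∀ {a b} → κ a ≡ κ b → rep a ≡ rep b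
      rep-cong {a} {b} κa≡κb = trans (cong (λ x → repOf x a) κa≡κb) (repOf-irrelevant b κa≡κb)

      𝟙-rep : ∀ t k → 𝟙 (t ≟ rep k) ≡ 𝟙 (t ≟ rep t) * 𝟙 (κ k ≟ κ t)
      𝟙-rep t k with t ≟ rep t
      ... | yes t≡rep[t] = trans (𝟙-cong (t ≟ rep k) (κ k ≟ κ t)
                                   (λ t≡rep[k] → trans (sym (κ-rep k)) (cong κ (sym t≡rep[k])))
                                   (λ κk≡κt → trans t≡rep[t] (rep-cong (sym κk≡κt))))
                                 (sym (ℚ.*-identityˡ _))
      ... | no  t≢rep[t] = trans (𝟙-no (t ≟ rep k) λ t≡rep[k] → t≢rep[t] (begin
                                   t             ≡⟨ t≡rep[k] ⟩
                                   rep k         ≡⟨ rep-cong (κ-rep k) ⟨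
                                   rep (rep k)   ≡⟨ cong rep t≡rep[k] ⟨
                                   rep t         ∎))
                                 (sym (ℚ.*-zeroˡ (𝟙 (κ k ≟ κ t))))
        where open ≡-Reasoning

      -- A vector with vanishing block sums is Σₖ vₖ (eₖ − e_{rep k}); the terms with k = rep k vanish.
      term : Vecℚ n → Fin n → List ((Fin n × Fin n) × ℚ)
      term v k with k ≟ rep k
      ... | yes _ = []
      ... | no  _ = ((k , rep k) , v k) ∷ []

      term-sameBlock : ∀ v k → All (uncurry (SameBlock κ) ∘ proj₁) (term v k)
      term-sameBlock v k with k ≟ rep k
      ... | yes _      = []
      ... | no  k≢rep[k] = (k≢rep[k] , sym (κ-rep k)) ∷ []

      lincomb-term : ∀ v k t → lincomb (term v k) t ≡ v k * (𝟙 (t ≟ k) - 𝟙 (t ≟ rep k))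
      lincomb-term v k t with k ≟ rep k
      ... | yes k≡rep[k] = sym (trans (cong (λ r → v k * (𝟙 (t ≟ k) - 𝟙 (t ≟ r))) (sym k≡rep[k]))
                                      (trans (cong (v k *_) (ℚ.+-inverseʳ (𝟙 (t ≟ k)))) (ℚ.*-zeroʳ (v k))))
      ... | no  k≢rep[k] = trans (ℚ.+-identityʳ _) (cong (v k *_) (root≡𝟙-𝟙 k≢rep[k] t))

    balanced⇒lincomb : ∀ {v} → Balanced κ v → ∀ t → v t ≡ lincomb (concat (tabulate (term v))) t
    balanced⇒lincomb {v} bal t = sym (begin
      lincomb (concat (tabulate (term v))) t
        ≡⟨ lincomb-concat (term v) t ⟩
      sum (λ k → lincomb (term v k) t)
        ≡⟨ sum-cong-≗ (λ k → trans (lincomb-term v k t) (regroup k)) ⟩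
      sum (λ k → 𝟙 (k ≟ t) * v k - c * (𝟙 (κ k ≟ κ t) * v k))
        ≡⟨ sum-- (λ k → 𝟙 (k ≟ t) * v k) (λ k → c * (𝟙 (κ k ≟ κ t) * v k)) ⟩
      sum (λ k → 𝟙 (k ≟ t) * v k) - sum (λ k → c * (𝟙 (κ k ≟ κ t) * v k))
        ≡⟨ cong₂ _-_ (sum-𝟙* v t) (sym (*-distribˡ-sum {n} c (λ k → 𝟙 (κ k ≟ κ t) * v k))) ⟩
      v t - c * blockSum κ (κ t) v
        ≡⟨ cong (λ x → v t - c * x) (bal (κ t)) ⟩
      v t - c * 0ℚ
        ≡⟨ solve 2 (λ x y → x :- y :* con 0ℚ := x) refl (v t) c ⟩
      v t ∎)
      where
      open ≡-Reasoning
      c = 𝟙 (t ≟ rep t)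
      regroup : ∀ k → v k * (𝟙 (t ≟ k) - 𝟙 (t ≟ rep k)) ≡ 𝟙 (k ≟ t) * v k - c * (𝟙 (κ k ≟ κ t) * v k)
      regroup k = trans (cong₂ (λ x y → v k * (x - y)) (𝟙-cong (t ≟ k) (k ≟ t) sym sym) (𝟙-rep t k))
                        (solve 4 (λ x a b c → x :* (a :- b :* c) := a :* x :- b :* (c :* x)) refl
                                 (v k) (𝟙 (k ≟ t)) c (𝟙 (κ k ≟ κ t)))

    sameBlock? : ∀ p → Dec (uncurry (SameBlock κ) p)
    sameBlock? (i , j) = ¬? (i ≟ j) ×-dec κ i ≟ κ j

    sameBlockPairs : List (Fin n × Fin n)
    sameBlockPairs = filter sameBlock? (cartesianProduct (allFin n) (allFin n))

    ∈-sameBlockPairs⁺ : ∀ {i j} → SameBlock κ i j → (i , j) ∈ sameBlockPairs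
    ∈-sameBlockPairs⁺ {i} {j} = ∈-filter⁺ sameBlock? (∈-cartesianProduct⁺ (∈-allFin i) (∈-allFin j))

    sameBlockPairs-sameBlock : All (uncurry (SameBlock κ)) sameBlockPairs
    sameBlockPairs-sameBlock =
      All.tabulate (proj₂ ∘ ∈-filter⁻ sameBlock? {xs = cartesianProduct (allFin n) (allFin n)})

    balanced⇒span : ∀ {v} → Balanced κ v → InSpan sameBlockPairs v
    balanced⇒span {v} bal =
      concat (tabulate (term v)) ,
      All.concat⁺ (All.tabulate⁺ λ k → All.map ∈-sameBlockPairs⁺ (term-sameBlock v k)) ,
      balanced⇒lincomb bal

    balanced-isRootSubspace : IsRootSubspace n (Balanced κ)
    balanced-isRootSubspace =
      sameBlockPairs , All.map proj₁ sameBlockPairs-sameBlock ,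
      λ v → balanced⇒span , span⇒balanced sameBlockPairs-sameBlock

module _ {n p q} (α : Fin n → Fin p) (β : Fin n → Fin q) where

  blockSum-∑ʳ : ∀ x v → sum (λ y → blockSum < α , β > (x , y) v) ≡ blockSum α x v
  blockSum-∑ʳ x v = trans (∑-comm {q} {n} _) (sum-cong-≗ row)
    where
    row : ∀ k → sum (λ y → 𝟙 ((α k , β k) ≟ (x , y)) * v k) ≡ 𝟙 (α k ≟ x) * v k
    row k = trans (sum-select (β k) λ y y≢βk →
                     trans (cong (_* v k) (𝟙-no ((α k , β k) ≟ (x , y)) (y≢βk ∘ sym ∘ cong proj₂)))
                           (ℚ.*-zeroˡ (v k)))
                  (cong (_* v k) (𝟙-cong ((α k , β k) ≟ (x , β k)) (α k ≟ x) (cong proj₁) (cong (_, β k))))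

  blockSum-∑ˡ : ∀ y v → sum (λ x → blockSum < α , β > (x , y) v) ≡ blockSum β y v
  blockSum-∑ˡ y v = trans (∑-comm {p} {n} _) (sum-cong-≗ col)
    where
    col : ∀ k → sum (λ x → 𝟙 ((α k , β k) ≟ (x , y)) * v k) ≡ 𝟙 (β k ≟ y) * v k
    col k = trans (sum-select (α k) λ x x≢αk →
                     trans (cong (_* v k) (𝟙-no ((α k , β k) ≟ (x , y)) (x≢αk ∘ sym ∘ cong proj₁)))
                           (ℚ.*-zeroˡ (v k)))
                  (cong (_* v k) (𝟙-cong ((α k , β k) ≟ (α k , y)) (β k ≟ y) (cong proj₂) (cong (α k ,_))))

  refinement⊆∩ : Balanced < α , β > ⊆ Balanced α ∩ Balanced β
  refinement⊆∩ {v} bal =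
    (λ x → trans (sym (blockSum-∑ʳ x v)) (sum-zero λ y → bal (x , y))) ,
    (λ y → trans (sym (blockSum-∑ˡ y v)) (sum-zero λ x → bal (x , y)))

-- Union–find along an edge list: each edge (i , j) renames the class of j to that of i.
relabel : ∀ {n} → Fin n → Fin n → Fin n → Fin n
relabel a b x with x ≟ b
... | yes _ = a
... | no  _ = x

relabel-≡ : ∀ {n} {a b x : Fin n} → x ≡ b → relabel a b x ≡ a
relabel-≡ {b = b} {x = x} x≡b with x ≟ b
... | yes _   = refl
... | no  x≢b = contradiction x≡b x≢b

relabel-≢ : ∀ {n} {a b x : Fin n} → x ≢ b → relabel a b x ≡ x
relabel-≢ {b = b} {x = x} x≢b with x ≟ b
... | yes x≡b = contradiction x≡b x≢b
... | no  _   = refl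

relabel-self : ∀ {n} {a b : Fin n} → relabel a b a ≡ a
relabel-self {a = a} {b} with a ≟ b
... | yes _ = refl
... | no  _ = refl

components : ∀ {n} → List (Fin n × Fin n) → Fin n → Fin n
components []             k = k
components ((i , j) ∷ es) k = relabel (components es i) (components es j) (components es k)

components-∈ : ∀ {n} (es : List (Fin n × Fin n)) {i j} → (i , j) ∈ es → components es i ≡ components es j
components-∈ ((i , j) ∷ es) (here refl) =
  trans (relabel-self {b = components es j})
        (sym (relabel-≡ {a = components es i} {x = components es j} refl))
components-∈ ((i , j) ∷ es) (there ij∈es) = cong (relabel _ _) (components-∈ es ij∈es)

module _ {n} {R : Fin n → Fin n → Set} (isEquivalence : IsEquivalence R) where
  open IsEquivalence isEquivalence renaming (refl to R-refl; sym to R-sym; trans to R-trans)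

  components-minimal : ∀ es → All (uncurry R) es → ∀ {a b} → components es a ≡ components es b → R a b
  components-minimal []             []            refl = R-refl
  components-minimal ((i , j) ∷ es) (Rij ∷ R-es) {a} {b} ca≡cb =
    merge (components es a ≟ components es j) (components es b ≟ components es j)
    where
    ih = components-minimal es R-es
    merge : Dec (components es a ≡ components es j) → Dec (components es b ≡ components es j) → R a b
    merge (yes ca≡cj) (yes cb≡cj) = ih (trans ca≡cj (sym cb≡cj))
    merge (yes ca≡cj) (no  cb≢cj) =
      R-trans (ih ca≡cj) (R-trans (R-sym Rij)
        (ih (trans (sym (relabel-≡ ca≡cj)) (trans ca≡cb (relabel-≢ cb≢cj)))))
    merge (no  ca≢cj) (yes cb≡cj) =
      R-trans (ih (trans (sym (relabel-≢ ca≢cj)) (trans ca≡cb (relabel-≡ cb≡cj))))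
        (R-trans Rij (R-sym (ih cb≡cj)))
    merge (no  ca≢cj) (no  cb≢cj) = ih (trans (sym (relabel-≢ ca≢cj)) (trans ca≡cb (relabel-≢ cb≢cj)))

module _ {n} (rs : List (Fin n × Fin n)) where

  Linked : Fin n → Fin n → Set
  Linked a b = a ≡ b ⊎ InSpan rs (root a b)

  linked-isEquivalence : IsEquivalence Linked
  linked-isEquivalence = record { refl = inj₁ refl ; sym = linked-sym ; trans = linked-trans }
    where
    linked-sym : ∀ {a b} → Linked a b → Linked b a
    linked-sym         (inj₁ a≡b) = inj₁ (sym a≡b)
    linked-sym {a} {b} (inj₂ ab) with a ≟ b
    ... | yes a≡b = inj₁ (sym a≡b)
    ... | no  a≢b = inj₂ (span-≗ (span-* (- 1ℚ) ab) (root-antisym a≢b))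

    linked-trans : ∀ {a b c} → Linked a b → Linked b c → Linked a c
    linked-trans (inj₁ refl) bc          = bc
    linked-trans ab          (inj₁ refl) = ab
    linked-trans {a} {b} {c} (inj₂ ab) (inj₂ bc) with a ≟ b | b ≟ c | a ≟ c
    ... | _        | _        | yes a≡c = inj₁ a≡c
    ... | yes refl | _        | no  _   = inj₂ bc
    ... | no  _    | yes refl | no  _   = inj₂ ab
    ... | no  a≢b  | no  b≢c  | no  a≢c = inj₂ (span-≗ (span-+ ab bc) (root-trans a≢b b≢c a≢c))

rootSubspace-labelling : ∀ {n L} → IsRootSubspace n L → Σ (Fin n → Fin n) λ α → ∀ v → L v ⇔ Balanced α v
rootSubspace-labelling {n} {L} (rs , rs-distinct , L⇔span) =
  α , λ v → mk⇔ (span⇒balanced α rs-sameBlock ∘ proj₁ (L⇔span v))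
                (proj₂ (L⇔span v) ∘ span-mono generator ∘ balanced⇒span α)
  where
  α = components rs

  rs-sameBlock : All (uncurry (SameBlock α)) rs
  rs-sameBlock = All.tabulate λ ij∈rs → All.lookup rs-distinct ij∈rs , components-∈ rs ij∈rs

  generator : ∀ {i j} → (i , j) ∈ sameBlockPairs α → InSpan rs (root i j)
  generator ij∈pairs with i≢j , αi≡αj ← All.lookup (sameBlockPairs-sameBlock α) ij∈pairs
    with components-minimal (linked-isEquivalence rs) rs (All.tabulate (inj₂ ∘ span-root)) αi≡αj
  ... | inj₁ i≡j = contradiction i≡j i≢j
  ... | inj₂ ij  = ij

isRootSubspace-resp : ∀ {n} {P Q : Vecℚ n → Set} → (∀ v → P v ⇔ Q v) →
                      IsRootSubspace n P → IsRootSubspace n Q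
isRootSubspace-resp P⇔Q (rs , rs-distinct , P⇔span) =
  rs , rs-distinct ,
  λ v → proj₁ (P⇔span v) ∘ Equivalence.from (P⇔Q v) , Equivalence.to (P⇔Q v) ∘ proj₂ (P⇔span v)

module _ {n p q} {P : Vecℚ n → Set} (α : Fin n → Fin p) (β : Fin n → Fin q)
         (P⇔α∩β : ∀ v → P v ⇔ (Balanced α ∩ Balanced β) v) where

  isRootSubspace⇔∩⊆refinement : IsRootSubspace n P ⇔ (Balanced α ∩ Balanced β ⊆ Balanced < α , β >)
  isRootSubspace⇔∩⊆refinement = mk⇔ to from
    where
    to : IsRootSubspace n P → Balanced α ∩ Balanced β ⊆ Balanced < α , β >
    to (rs , rs-distinct , P⇔span) {v} v∈α∩β =
      span⇒balanced < α , β > rs-sameBlock (proj₁ (P⇔span v) (Equivalence.from (P⇔α∩β v) v∈α∩β))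
      where
      rs-sameBlock : All (uncurry (SameBlock < α , β >)) rs
      rs-sameBlock = All.tabulate λ {(i , j)} ij∈rs →
        let i≢j = All.lookup rs-distinct ij∈rs
            bα , bβ = Equivalence.to (P⇔α∩β (root i j)) (proj₂ (P⇔span (root i j)) (span-root ij∈rs))
        in i≢j , cong₂ _,_ (Equivalence.to (balanced-root⇔ α i≢j) bα)
                           (Equivalence.to (balanced-root⇔ β i≢j) bβ)

    from : Balanced α ∩ Balanced β ⊆ Balanced < α , β > → IsRootSubspace n P
    from meet = isRootSubspace-resp refinement⇔P (balanced-isRootSubspace < α , β >)
      where
      refinement⇔P : ∀ v → Balanced < α , β > v ⇔ P v
      refinement⇔P v = mk⇔ (Equivalence.from (P⇔α∩β v) ∘ refinement⊆∩ α β)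
                   (meet ∘ Equivalence.to (P⇔α∩β v))

Chordal : ∀ {n} → (Fin n → Fin n → Set) → Set
Chordal {n} Adj = ∀ k (c : Fin (4 ℕ.+ k) → Fin n) → IsCycle Adj c → HasChord Adj c

chordal-resp : ∀ {n} {Adj Adj′ : Fin n → Fin n → Set} → (∀ i j → Adj i j ⇔ Adj′ i j) →
               Chordal Adj → Chordal Adj′
chordal-resp Adj⇔Adj′ chordal k c (c-injective , c-adjacent) =
  let a , b , a≢b , b≢a⁺ , a≢b⁺ , adjacent =
        chordal k c (c-injective , λ a → Equivalence.from (Adj⇔Adj′ _ _) (c-adjacent a))
  in a , b , a≢b , b≢a⁺ , a≢b⁺ , Equivalence.to (Adj⇔Adj′ _ _) adjacent

chordal-⇔ : ∀ {n} {Adj Adj′ : Fin n → Fin n → Set} → (∀ i j → Adj i j ⇔ Adj′ i j) → Chordal Adj ⇔ Chordal Adj′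
chordal-⇔ Adj⇔Adj′ = mk⇔ (chordal-resp Adj⇔Adj′) (chordal-resp λ i j → ⇔.sym (Adj⇔Adj′ i j))

hasChord? : ∀ {n m} {Adj : Fin n → Fin n → Set} → (∀ i j → Dec (Adj i j)) →
            (c : Fin (suc m) → Fin n) → Dec (HasChord Adj c)
hasChord? adj? c = any? λ a → any? λ b →
  ¬? (a ≟ b) ×-dec ¬? (b ≟ next a) ×-dec ¬? (a ≟ next b) ×-dec adj? (c a) (c b)

module ChordlessCycle {n k} {Adj : Fin n → Fin n → Set} {c : Fin (4 ℕ.+ k) → Fin n}
                      (cycle : IsCycle Adj c) (chordless : ¬ HasChord Adj c) where

  ¬adjacent-next∘next : ∀ a → ¬ Adj (c a) (c (next (next a)))
  ¬adjacent-next∘next a adj = chordless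
    (a , next (next a) , next∘next≢id a ∘ sym , next≢id (next a) , next∘next∘next≢id a ∘ sym , adj)

  adjacent⇒consecutive : ∀ {a b} → Adj (c a) (c b) → a ≢ b → b ≡ next a ⊎ a ≡ next b
  adjacent⇒consecutive {a} {b} adj a≢b with b ≟ next a | a ≟ next b
  ... | yes b≡a⁺ | _        = inj₁ b≡a⁺
  ... | no  _    | yes a≡b⁺ = inj₂ a≡b⁺
  ... | no  b≢a⁺ | no  a≢b⁺ = contradiction (a , b , a≢b , b≢a⁺ , a≢b⁺ , adj) chordless

SameEitherBlock : ∀ {n p q} → (Fin n → Fin p) → (Fin n → Fin q) → Fin n → Fin n → Set
SameEitherBlock α β i j = SameBlock α i j ⊎ SameBlock β i j

sameEitherBlock? : ∀ {n p q} (α : Fin n → Fin p) (β : Fin n → Fin q) i j → Dec (SameEitherBlock α β i j)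
sameEitherBlock? α β i j = (¬? (i ≟ j) ×-dec α i ≟ α j) ⊎-dec (¬? (i ≟ j) ×-dec β i ≟ β j)

module ChordlessTwoColouredCycle {n p q k} (α : Fin n → Fin p) (β : Fin n → Fin q)
                                 {c : Fin (4 ℕ.+ k) → Fin n} (cycle : IsCycle (SameEitherBlock α β) c)
                                 (chordless : ¬ HasChord (SameEitherBlock α β) c) where
  open ChordlessCycle {Adj = SameEitherBlock α β} cycle chordless

  αEdge βEdge : Fin (4 ℕ.+ k) → Set
  αEdge a = α (c a) ≡ α (c (next a))
  βEdge a = β (c a) ≡ β (c (next a))

  edge-colour : ∀ a → αEdge a ⊎ βEdge a
  edge-colour a = Sum.map proj₂ proj₂ (proj₂ cycle a)

  c≢c∘next∘next : ∀ a → c a ≢ c (next (next a))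
  c≢c∘next∘next a = next∘next≢id a ∘ sym ∘ proj₁ cycle

  ¬αEdge-twice : ∀ a → αEdge a → ¬ αEdge (next a)
  ¬αEdge-twice a e e′ = ¬adjacent-next∘next a (inj₁ (c≢c∘next∘next a , trans e e′))

  ¬βEdge-twice : ∀ a → βEdge a → ¬ βEdge (next a)
  ¬βEdge-twice a e e′ = ¬adjacent-next∘next a (inj₂ (c≢c∘next∘next a , trans e e′))

  ¬αEdge⇒βEdge : ∀ {a} → ¬ αEdge a → βEdge a
  ¬αEdge⇒βEdge {a} ¬αe = [ flip contradiction ¬αe , id ] (edge-colour a)

  ¬αβEdge : ∀ a → αEdge a → ¬ βEdge a
  ¬αβEdge a αe βe = [ ¬αEdge-twice a αe , ¬βEdge-twice a βe ] (edge-colour (next a))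

  labels-determine-vertex : ∀ {a b} → α (c a) ≡ α (c b) → β (c a) ≡ β (c b) → a ≡ b
  labels-determine-vertex {a} {b} αa≡αb βa≡βb with a ≟ b
  ... | yes a≡b = a≡b
  ... | no  a≢b with adjacent⇒consecutive (inj₁ (a≢b ∘ proj₁ cycle , αa≡αb)) a≢b
  ...   | inj₁ refl = contradiction βa≡βb (¬αβEdge a αa≡αb)
  ...   | inj₂ refl = contradiction (sym βa≡βb) (¬αβEdge b (sym αa≡αb))

  dα : Fin (4 ℕ.+ k) → ℚ
  dα a = 𝟙 (α (c a) ≟ α (c (next a)))

  dα-alternates : ∀ a → dα (next a) - dα a ≢ 0ℚ
  dα-alternates a with α (c (next a)) ≟ α (c (next (next a))) | α (c a) ≟ α (c (next a))
  ... | yes αe′  | yes αe  = contradiction αe′ (¬αEdge-twice a αe)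
  ... | yes _    | no  _   = λ ()
  ... | no  _    | yes _   = λ ()
  ... | no  ¬αe′ | no  ¬αe = λ _ → ¬βEdge-twice a (¬αEdge⇒βEdge ¬αe) (¬αEdge⇒βEdge ¬αe′)

  -- It lies in L, as each of its roots joins two vertices of one α-block, and in M, as the roots
  -- around the cycle sum to zero and all other edges are β-edges.
  αEdgeSum : Vecℚ n
  αEdgeSum t = sum (λ a → dα a * root (c a) (c (next a)) t)

  blockSum-αEdgeSum : ∀ {K} {{_ : IsDecEquivalence {A = K} _≡_}} (κ : Fin n → K) x →
                      blockSum κ x αEdgeSum ≡ sum (λ a → dα a * (𝟙 (κ (c a) ≟ x) - 𝟙 (κ (c (next a)) ≟ x)))
  blockSum-αEdgeSum κ x = blockSum-∑root κ x dα c (c ∘ next) λ a → [ proj₁ , proj₁ ] (proj₂ cycle a)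

  αEdgeSum-balanced-α : Balanced α αEdgeSum
  αEdgeSum-balanced-α x =
    trans (blockSum-αEdgeSum α x) (sum-zero λ a → 𝟙[≟]*diff≡0 (α (c a)) (α (c (next a))) x)

  αEdgeSum-balanced-β : Balanced β αEdgeSum
  αEdgeSum-balanced-β x = begin
    blockSum β x αEdgeSum                                          ≡⟨ blockSum-αEdgeSum β x ⟩
    sum (λ a → dα a * (𝟙 (β (c a) ≟ x) - 𝟙 (β (c (next a)) ≟ x))) ≡⟨ sum-cong-≗ dα*diff≡diff ⟩
    sum (λ a → 𝟙 (β (c a) ≟ x) - 𝟙 (β (c (next a)) ≟ x))          ≡⟨ sum-telescope (λ a → 𝟙 (β (c a) ≟ x)) ⟩
    0ℚ                                                             ∎
    where
    open ≡-Reasoning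
    dα*diff≡diff : ∀ a → 𝟙 (α (c a) ≟ α (c (next a))) * (𝟙 (β (c a) ≟ x) - 𝟙 (β (c (next a)) ≟ x)) ≡
                         𝟙 (β (c a) ≟ x) - 𝟙 (β (c (next a)) ≟ x)
    dα*diff≡diff a with α (c a) ≟ α (c (next a))
    ... | yes _   = ℚ.*-identityˡ _
    ... | no  ¬αe = trans (ℚ.*-zeroˡ (𝟙 (β (c a) ≟ x) - 𝟙 (β (c (next a)) ≟ x)))
                          (sym (𝟙[≡]-diff≡0 x (¬αEdge⇒βEdge ¬αe)))

  αEdgeSum-unbalanced : blockSum < α , β > (< α , β > (c zero)) αEdgeSum ≢ 0ℚ
  αEdgeSum-unbalanced blockSum≡0 = dα-alternates last (begin
    dα (next last) - dα last                                 ≡⟨ cong (λ b → dα b - dα last) (next-fromℕ _) ⟩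
    dα zero - dα last                                        ≡⟨ sum-*[𝟙-𝟙∘next] dα ⟨
    sum (λ a → dα a * (𝟙 (a ≟ zero) - 𝟙 (next a ≟ zero)))
                                                             ≡⟨ sum-cong-≗ (λ a → cong (dα a *_)
                                                                  (cong₂ _-_ (at-vertex a) (at-vertex (next a)))) ⟨
    sum (λ a → dα a * (𝟙 (κ (c a) ≟ κ (c zero)) - 𝟙 (κ (c (next a)) ≟ κ (c zero))))
                                                             ≡⟨ blockSum-αEdgeSum κ (κ (c zero)) ⟨
    blockSum κ (κ (c zero)) αEdgeSum                         ≡⟨ blockSum≡0 ⟩
    0ℚ                                                       ∎)
    where
    open ≡-Reasoning
    last = fromℕ (3 ℕ.+ k)
    κ = < α , β >
    at-vertex : ∀ a → 𝟙 (κ (c a) ≟ κ (c zero)) ≡ 𝟙 (a ≟ zero)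
    at-vertex a = 𝟙-cong (κ (c a) ≟ κ (c zero)) (a ≟ zero)
                         (λ e → labels-determine-vertex (cong proj₁ e) (cong proj₂ e)) (cong (κ ∘ c))

∩⊆refinement⇒chordal : ∀ {n p q} (α : Fin n → Fin p) (β : Fin n → Fin q) →
                       Balanced α ∩ Balanced β ⊆ Balanced < α , β > → Chordal (SameEitherBlock α β)
∩⊆refinement⇒chordal α β meet k c cycle with hasChord? (sameEitherBlock? α β) c
... | yes chord     = chord
... | no  chordless = contradiction (meet (αEdgeSum-balanced-α , αEdgeSum-balanced-β) _) αEdgeSum-unbalanced
  where open ChordlessTwoColouredCycle α β cycle chordless

InjectiveBelow : ∀ {V : Set} → (ℕ → V) → ℕ → Set
InjectiveBelow f q = ∀ {s t} → s < q → t < q → f s ≡ f t → s ≡ t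

FirstRepetition : ∀ {V : Set} → (ℕ → V) → Set
FirstRepetition f = Σ ℕ λ p → Σ ℕ λ q → p < q × f p ≡ f q × InjectiveBelow f q

injectiveBelow⊎firstRepetition : ∀ {m} (f : ℕ → Fin m) q → InjectiveBelow f q ⊎ FirstRepetition f
injectiveBelow⊎firstRepetition f zero    = inj₁ λ ()
injectiveBelow⊎firstRepetition f (suc q) with injectiveBelow⊎firstRepetition f q
... | inj₂ repetition = inj₂ repetition
... | inj₁ injective with any? (λ (i : Fin q) → f (toℕ i) ≟ f q)
...   | yes (i , fi≡fq) = inj₂ (toℕ i , q , toℕ<n i , fi≡fq , injective)
...   | no  ¬repeat     = inj₁ injective′
  where
  new : ∀ {s} → s < q → f s ≢ f q
  new s<q fs≡fq = ¬repeat (fromℕ< s<q , trans (cong f (toℕ-fromℕ< s<q)) fs≡fq)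

  injective′ : InjectiveBelow f (suc q)
  injective′ s<1+q t<1+q fs≡ft with ℕ.m<1+n⇒m<n∨m≡n s<1+q | ℕ.m<1+n⇒m<n∨m≡n t<1+q
  ... | inj₁ s<q  | inj₁ t<q  = injective s<q t<q fs≡ft
  ... | inj₁ s<q  | inj₂ refl = contradiction fs≡ft (new s<q)
  ... | inj₂ refl | inj₁ t<q  = contradiction (sym fs≡ft) (new t<q)
  ... | inj₂ refl | inj₂ refl = refl

first-repetition : ∀ {m} (f : ℕ → Fin m) → FirstRepetition f
first-repetition {m} f with injectiveBelow⊎firstRepetition f (suc m)
... | inj₂ repetition = repetition
... | inj₁ injective  with i , j , i<j , fi≡fj ← pigeonhole (ℕ.n<1+n m) (f ∘ toℕ) =
  contradiction (injective (toℕ<n i) (toℕ<n j) fi≡fj) (ℕ.<⇒≢ i<j)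

module _ {V : Set} {E : V → V → Set} (f : ℕ → V) (f-step : ∀ s → E (f s) (f (suc s)))
         (f-irreflexive : ∀ s → f (suc s) ≢ f s) (f-nonbacktracking : ∀ s → f (suc (suc s)) ≢ f s) where

  closed-walk⇒cycle : ∀ {q} → 0 < q → f 0 ≡ f q → InjectiveBelow f q →
                      Σ ℕ λ k → Σ (Fin (3 ℕ.+ k) → V) λ w → Injective _≡_ _≡_ w × (∀ a → E (w a) (w (next a)))
  closed-walk⇒cycle {1}                   _ f0≡f1 _         = contradiction (sym f0≡f1) (f-irreflexive 0)
  closed-walk⇒cycle {2}                   _ f0≡f2 _         = contradiction (sym f0≡f2) (f-nonbacktracking 0)
  closed-walk⇒cycle {suc (suc (suc k))} _ f0≡fq injective =
    k , w , (λ {a} {b} wa≡wb → toℕ-injective (injective (toℕ<n a) (toℕ<n b) wa≡wb)) , w-step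
    where
    w : Fin (3 ℕ.+ k) → V
    w a = f (toℕ a)

    w-step : ∀ a → E (w a) (w (next a))
    w-step a with view a
    ... | ‵fromℕ = subst₂ (λ x y → E (f x) y) (sym (toℕ-fromℕ (2 ℕ.+ k)))
                          (trans (sym f0≡fq) (cong (f ∘ toℕ) (sym (next-fromℕ (2 ℕ.+ k)))))
                          (f-step (2 ℕ.+ k))
    ... | ‵inject₁ i = subst₂ (λ x y → E (f x) (f y)) (sym (toℕ-inject₁ i))
                              (cong toℕ (sym (next-inject₁ i))) (f-step (toℕ i))

module _ {m} {V : Set} {E : V → V → Set} (ι : V → Fin m) (ι-injective : Injective _≡_ _≡_ ι)
         (E-irreflexive : ∀ {u u′} → E u u′ → u ≢ u′)
         (E-extend : ∀ {u u′} → E u u′ → Σ V λ u″ → u″ ≢ u × E u′ u″) where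

  private
    module Walk {u₀ u₁} (e₀ : E u₀ u₁) where
      walk : ℕ → Σ (V × V) (uncurry E)
      walk zero    = (u₀ , u₁) , e₀
      walk (suc s) = (proj₂ (proj₁ (walk s)) , proj₁ (E-extend (proj₂ (walk s)))) ,
                     proj₂ (proj₂ (E-extend (proj₂ (walk s))))

      position : ℕ → V
      position s = proj₁ (proj₁ (walk s))

      position-step : ∀ s → E (position s) (position (suc s))
      position-step s = proj₂ (walk s)

      position-irreflexive : ∀ s → position (suc s) ≢ position s
      position-irreflexive s = E-irreflexive (position-step s) ∘ sym

      position-nonbacktracking : ∀ s → position (suc (suc s)) ≢ position s
      position-nonbacktracking s = proj₁ (proj₂ (E-extend (proj₂ (walk s))))

  edge⇒cycle : ∀ {u₀ u₁} → E u₀ u₁ →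
               Σ ℕ λ k → Σ (Fin (3 ℕ.+ k) → V) λ w → Injective _≡_ _≡_ w × (∀ a → E (w a) (w (next a)))
  edge⇒cycle e₀ with p , q , p<q , ιfp≡ιfq , injective ← first-repetition (ι ∘ Walk.position e₀) =
    closed-walk⇒cycle {E = E} (λ s → position (s ℕ.+ p))
      (λ s → position-step (s ℕ.+ p))
      (λ s → position-irreflexive (s ℕ.+ p))
      (λ s → position-nonbacktracking (s ℕ.+ p))
      (ℕ.m<n⇒0<n∸m p<q)
      (trans (ι-injective ιfp≡ιfq) (cong position (sym q∸p+p≡q)))
      (λ s<q∸p t<q∸p fs≡ft → ℕ.+-cancelʳ-≡ p _ _ (injective (shift s<q∸p) (shift t<q∸p) (cong ι fs≡ft)))
    where
    open Walk e₀
    q∸p+p≡q : q ℕ.∸ p ℕ.+ p ≡ q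
    q∸p+p≡q = ℕ.m∸n+n≡m (ℕ.<⇒≤ p<q)
    shift : ∀ {s} → s < q ℕ.∸ p → s ℕ.+ p < q
    shift s<q∸p = subst (_ ℕ.<_) q∸p+p≡q (ℕ.+-monoˡ-< p s<q∸p)

bipartite⇒¬triangle : ∀ {V : Set} {E : V → V → Set} (side : V → Bool) →
                      (∀ {u u′} → E u u′ → side u ≢ side u′) →
                      (w : Fin 3 → V) → ¬ (∀ a → E (w a) (w (next a)))
bipartite⇒¬triangle side E⇒≢ w w-step =
  ¬three-distinct (side (w zero)) (side (w (suc zero))) (side (w (suc (suc zero))))
    (E⇒≢ (w-step zero)) (E⇒≢ (w-step (suc zero))) (E⇒≢ (w-step (suc (suc zero))))
  where
  ¬three-distinct : ∀ x y z → x ≢ y → y ≢ z → z ≢ x → ⊥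
  ¬three-distinct false false _     x≢y _   _   = x≢y refl
  ¬three-distinct true  true  _     x≢y _   _   = x≢y refl
  ¬three-distinct false true  false _   _   z≢x = z≢x refl
  ¬three-distinct false true  true  _   y≢z _   = y≢z refl
  ¬three-distinct true  false false _   y≢z _   = y≢z refl
  ¬three-distinct true  false true  _   _   z≢x = z≢x refl

module _ {n p q} (α : Fin n → Fin p) (β : Fin n → Fin q) where

  Incident : Fin n → Fin p ⊎ Fin q → Set
  Incident k u = u ≡ inj₁ (α k) ⊎ u ≡ inj₂ (β k)

  incident-shared : ∀ {i j u} → Incident i u → Incident j u → α i ≡ α j ⊎ β i ≡ β j
  incident-shared (inj₁ refl) (inj₁ αi≡αj) = inj₁ (inj₁-injective αi≡αj)
  incident-shared (inj₂ refl) (inj₂ βi≡βj) = inj₂ (inj₂-injective βi≡βj)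
  incident-shared (inj₁ refl) (inj₂ ())
  incident-shared (inj₂ refl) (inj₁ ())

  shared-incident : ∀ {i j} → α i ≡ α j ⊎ β i ≡ β j → Σ (Fin p ⊎ Fin q) λ u → Incident i u × Incident j u
  shared-incident {i} (inj₁ αi≡αj) = inj₁ (α i) , inj₁ refl , inj₁ (cong inj₁ αi≡αj)
  shared-incident {i} (inj₂ βi≡βj) = inj₂ (β i) , inj₂ refl , inj₂ (cong inj₂ βi≡βj)

  incident-ends : ∀ {k u u′ u″} → Incident k u → Incident k u′ → u ≢ u′ → Incident k u″ → u″ ≡ u ⊎ u″ ≡ u′
  incident-ends (inj₁ refl) (inj₁ refl) u≢u′ _           = contradiction refl u≢u′
  incident-ends (inj₂ refl) (inj₂ refl) u≢u′ _           = contradiction refl u≢u′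
  incident-ends (inj₁ refl) (inj₂ refl) _    (inj₁ refl) = inj₁ refl
  incident-ends (inj₁ refl) (inj₂ refl) _    (inj₂ refl) = inj₂ refl
  incident-ends (inj₂ refl) (inj₁ refl) _    (inj₁ refl) = inj₂ refl
  incident-ends (inj₂ refl) (inj₁ refl) _    (inj₂ refl) = inj₁ refl

  module LineGraphCycle {m} {w : Fin (3 ℕ.+ m) → Fin p ⊎ Fin q} (w-injective : Injective _≡_ _≡_ w)
                        {K : Fin (3 ℕ.+ m) → Fin n}
                        (K-incident : ∀ a → Incident (K a) (w a) × Incident (K a) (w (next a))) where

    ends : ∀ {a u} → Incident (K a) u → u ≡ w a ⊎ u ≡ w (next a)
    ends {a} = incident-ends (proj₁ (K-incident a)) (proj₂ (K-incident a)) (next≢id a ∘ sym ∘ w-injective)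

    incident⇒consecutive : ∀ {a b u} → Incident (K a) u → Incident (K b) u → a ≡ b ⊎ b ≡ next a ⊎ a ≡ next b
    incident⇒consecutive {a} {b} a∋u b∋u with ends a∋u | ends b∋u
    ... | inj₁ refl | inj₁ wa≡wb   = inj₁ (w-injective wa≡wb)
    ... | inj₁ refl | inj₂ wa≡wb⁺  = inj₂ (inj₂ (w-injective wa≡wb⁺))
    ... | inj₂ refl | inj₁ wa⁺≡wb  = inj₂ (inj₁ (sym (w-injective wa⁺≡wb)))
    ... | inj₂ refl | inj₂ wa⁺≡wb⁺ = inj₁ (next-injective (w-injective wa⁺≡wb⁺))

    K-injective : Injective _≡_ _≡_ K
    K-injective {a} {b} Ka≡Kb
      with ends {b} (subst (λ k → Incident k (w a)) Ka≡Kb (proj₁ (K-incident a)))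
         | ends {b} (subst (λ k → Incident k (w (next a))) Ka≡Kb (proj₂ (K-incident a)))
    ... | inj₁ wa≡wb  | _             = w-injective wa≡wb
    ... | inj₂ _      | inj₂ wa⁺≡wb⁺  = next-injective (w-injective wa⁺≡wb⁺)
    ... | inj₂ wa≡wb⁺ | inj₁ wa⁺≡wb   =
      contradiction (trans (cong next (sym (w-injective wa≡wb⁺))) (w-injective wa⁺≡wb)) (next∘next≢id b)

    lifted-cycle : IsCycle (SameEitherBlock α β) K
    lifted-cycle = K-injective , λ a →
      let Ka≢Ka⁺ = next≢id a ∘ sym ∘ K-injective
      in Sum.map (Ka≢Ka⁺ ,_) (Ka≢Ka⁺ ,_)
                 (incident-shared (proj₂ (K-incident a)) (proj₁ (K-incident (next a))))

    lifted-chordless : ¬ HasChord (SameEitherBlock α β) K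
    lifted-chordless (a , b , a≢b , b≢a⁺ , a≢b⁺ , adjacent)
      with u , a∋u , b∋u ← shared-incident (Sum.map proj₂ proj₂ adjacent)
      with incident⇒consecutive a∋u b∋u
    ... | inj₁ a≡b         = a≢b a≡b
    ... | inj₂ (inj₁ b≡a⁺) = b≢a⁺ b≡a⁺
    ... | inj₂ (inj₂ a≡b⁺) = a≢b⁺ a≡b⁺

module _ {n p q} (α : Fin n → Fin p) (β : Fin n → Fin q) (chordal : Chordal (SameEitherBlock α β))
         {v} (v∈α∩β : (Balanced α ∩ Balanced β) v) where

  private
    σ : Fin p → Fin q → ℚ
    σ x y = blockSum < α , β > (x , y) v

    Support : Fin p ⊎ Fin q → Fin p ⊎ Fin q → Set
    Support (inj₁ x) (inj₂ y) = σ x y ≢ 0ℚ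
    Support (inj₂ y) (inj₁ x) = σ x y ≢ 0ℚ
    Support _        _        = ⊥

    isLeft : Fin p ⊎ Fin q → Bool
    isLeft = [ const true , const false ]

    support-bipartite : ∀ {u u′} → Support u u′ → isLeft u ≢ isLeft u′
    support-bipartite {inj₁ _} {inj₂ _} _ ()
    support-bipartite {inj₂ _} {inj₁ _} _ ()

    support-irreflexive : ∀ {u u′} → Support u u′ → u ≢ u′
    support-irreflexive e = support-bipartite e ∘ cong isLeft

    support-extend : ∀ {u u′} → Support u u′ → Σ (Fin p ⊎ Fin q) λ u″ → u″ ≢ u × Support u′ u″
    support-extend {inj₁ x} {inj₂ y} σxy≢0
      with x′ , x′≢x , σx′y≢0 ← sum≡0⇒∃other≢0 (trans (blockSum-∑ˡ α β y v) (proj₂ v∈α∩β y)) σxy≢0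
      = inj₁ x′ , x′≢x ∘ inj₁-injective , σx′y≢0
    support-extend {inj₂ y} {inj₁ x} σxy≢0
      with y′ , y′≢y , σxy′≢0 ← sum≡0⇒∃other≢0 (trans (blockSum-∑ʳ α β x v) (proj₁ v∈α∩β x)) σxy≢0
      = inj₂ y′ , y′≢y ∘ inj₂-injective , σxy′≢0

    support-lift : ∀ {u u′} → Support u u′ → Σ (Fin n) λ k → Incident α β k u × Incident α β k u′
    support-lift {inj₁ x} {inj₂ y} σxy≢0 with k , κk≡xy ← blockSum≢0⇒inhabited < α , β > σxy≢0 =
      k , inj₁ (cong (inj₁ ∘ proj₁) (sym κk≡xy)) , inj₂ (cong (inj₂ ∘ proj₂) (sym κk≡xy))
    support-lift {inj₂ y} {inj₁ x} σxy≢0 with k , κk≡xy ← blockSum≢0⇒inhabited < α , β > σxy≢0 =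
      k , inj₂ (cong (inj₂ ∘ proj₂) (sym κk≡xy)) , inj₁ (cong (inj₁ ∘ proj₁) (sym κk≡xy))

    join-injective : Injective _≡_ _≡_ (join p q)
    join-injective {u} {u′} e =
      trans (sym (splitAt-join p q u)) (trans (cong (splitAt p) e) (splitAt-join p q u′))

  chordal⇒∩⊆refinement : Balanced < α , β > v
  chordal⇒∩⊆refinement (x , y) with σ x y ℚ.≟ 0ℚ
  ... | yes σxy≡0 = σxy≡0
  ... | no  σxy≢0
    with edge⇒cycle (join p q) join-injective support-irreflexive support-extend {inj₁ x} {inj₂ y} σxy≢0
  ...   | zero  , w , _           , w-step =
    contradiction w-step (bipartite⇒¬triangle {E = Support} isLeft support-bipartite w)
  ...   | suc k , w , w-injective , w-step =
    contradiction (chordal k K lifted-cycle) lifted-chordless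
    where
    K = λ a → proj₁ (support-lift (w-step a))
    open LineGraphCycle α β w-injective {K = K} (λ a → proj₂ (support-lift (w-step a)))

∩⊆refinement⇔chordal : ∀ {n p q} (α : Fin n → Fin p) (β : Fin n → Fin q) →
                       (Balanced α ∩ Balanced β ⊆ Balanced < α , β >) ⇔ Chordal (SameEitherBlock α β)
∩⊆refinement⇔chordal α β = mk⇔ (∩⊆refinement⇒chordal α β) (chordal⇒∩⊆refinement α β)

Γ⇔SameBlock : ∀ {n p} {L : Vecℚ n → Set} {α : Fin n → Fin p} → (∀ v → L v ⇔ Balanced α v) →
              ∀ i j → Γ L i j ⇔ SameBlock α i j
Γ⇔SameBlock {α = α} L⇔α i j = mk⇔
  (λ (i≢j , L[eᵢⱼ]) → i≢j , Equivalence.to (balanced-root⇔ α i≢j) (Equivalence.to (L⇔α _) L[eᵢⱼ]))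
  (λ (i≢j , αi≡αj) → i≢j , Equivalence.from (L⇔α _) (Equivalence.from (balanced-root⇔ α i≢j) αi≡αj))

lemma2p6 : ∀ n (L M : Vecℚ n → Set) →
    IsRootSubspace n L → IsRootSubspace n M →
    (IsRootSubspace n (L ∩ M) ⇔
      (∀ k (c : Fin (suc (suc (suc (suc k)))) → Fin n) →
        IsCycle (Γ∪ L M) c → HasChord (Γ∪ L M) c))
lemma2p6 n L M L-root M-root =
  let α , L⇔α = rootSubspace-labelling L-root
      β , M⇔β = rootSubspace-labelling M-root
  in ⇔.trans (isRootSubspace⇔∩⊆refinement α β λ v → L⇔α v ×-⇔ M⇔β v)
       (⇔.trans (∩⊆refinement⇔chordal α β)
         (chordal-⇔ {Adj = SameEitherBlock α β} λ i j →
           ⇔.sym (Γ⇔SameBlock L⇔α i j ⊎-⇔ Γ⇔SameBlock M⇔β i j)))
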